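{- (Provable in $\mathsf{PRS}\omega$.) Let $D,E$ be dilators and $\gamma$ an ordinal, and suppose the $\psi$-fixed point $\psi D^\gamma$ exists; put $\delta=\gamma+\psi D^\gamma$. If the $\psi$-fixed point $\psi E^\delta$ exists as well, then $\psi D^\gamma+\psi E^\delta$ is the $\psi$-fixed point of $(D+E)^\gamma$, i.e., $\psi(D+E)^\gamma=\psi D^\gamma+\psi E^\delta$.
   Context: $\mathsf{PRS}\omega$: language $\in,=$ plus function symbols for all Jensen–Karp primitive recursive set functions (with parameter $\omega$), with defining equations, equality, extensionality, foundation, infinity. Dilators: a predilator is a monotone functor $D$ from finite ordinals with embeddings to linear orders with natural maps $\operatorname{supp}_n:D(n)\to\mathcal P(n)$ such that $\operatorname{supp}_n(\sigma)\subseteq\operatorname{rng}(f)$ implies $\sigma\in\operatorname{rng}(D(f))$; it extends to all linear orders $X$: $D(X)$ is the set of $(\sigma;a_0,\dots,a_{n-1})$ with $a_0<\dots<a_{n-1}$ in $X$ and $\operatorname{supp}_n(\sigma)=n$, compared by transport into $D(|a\cup b|)$; $D(h)(\sigma,a)=(\sigma,h[a])$; $\operatorname{supp}_X(\sigma,a)=a$. A dilator is a predilator with $D(X)$ well-founded for all well orders $X$. $D+E$ is the sum: $(D+E)(X)$ is $D(X)$ followed by $E(X)$, with componentwise action and supports. For ordinals, $\gamma+f$ is the embedding that fixes $\gamma$ and maps $\gamma+x\mapsto\gamma+f(x)$. $D^\gamma$ is the dilator with $D^\gamma(\alpha)=D(\gamma+\alpha)$, $D^\gamma(f)=D(\gamma+f)$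 and support of $(\sigma;a_0,\dots,a_n)$ equal to $\{x:\gamma+x\in\{a_0,\dots,a_n\}\}$. An ordinal $\theta$ is a $\psi$-fixed point of a predilator $D$ if there is an order embedding $\pi:\theta\to D(\theta)$ such that (1) $\alpha\in\operatorname{supp}_\theta(\pi(\beta))\Rightarrow\alpha<\beta$ for all $\alpha,\beta<\theta$, and (2) for every $\tau\in D(\theta)$, if $\pi(\alpha)<\tau$ for all $\alpha\in\operatorname{supp}_\theta(\tau)$, then $\tau\in\operatorname{rng}(\pi)$. A dilator has at most one $\psi$-fixed point; it is denoted $\psi D$. -}

module Defs where

open import Data.Nat using (ℕ)
open import Data.Fin using (Fin) renaming (_<_ to _<ᶠ_)
open import Data.Sum using (_⊎_; inj₁; inj₂)
import Data.Sum as Sum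
open import Data.Product using (Σ; ∃; _×_; _,_)
open import Relation.Binary.Structures using (IsStrictTotalOrder)
open import Induction.WellFounded using (WellFounded)
open import Relation.Binary.PropositionalEquality using (_≡_)
open import Function using (_∘_; id)

record LinOrd : Set₁ where
  field
    Carrier : Set
    _<_     : Carrier → Carrier → Set

open LinOrd public

IsWellOrder : LinOrd → Set
IsWellOrder X = IsStrictTotalOrder _≡_ (_<_ X) × WellFounded (_<_ X)

Increasing : (X Y : LinOrd) → (Carrier X → Carrier Y) → Set
Increasing X Y h = ∀ {x y} → _<_ X x y → _<_ Y (h x) (h y)

fin : ℕ → LinOrd
fin n = record { Carrier = Fin n ; _<_ = _<ᶠ_ }

FinIncreasing : ∀ {m n} → (Fin m → Fin n) → Set
FinIncreasing {m} {n} f = Increasing (fin m) (fin n) f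

data SumLt {A B : Set} (RA : A → A → Set) (RB : B → B → Set) : A ⊎ B → A ⊎ B → Set where
  ₁<₁ : ∀ {a a'} → RA a a' → SumLt RA RB (inj₁ a) (inj₁ a')
  ₁<₂ : ∀ {a b} → SumLt RA RB (inj₁ a) (inj₂ b)
  ₂<₂ : ∀ {b b'} → RB b b' → SumLt RA RB (inj₂ b) (inj₂ b')

data SumEq {A B : Set} (RA : A → A → Set) (RB : B → B → Set) : A ⊎ B → A ⊎ B → Set where
  ₁≈₁ : ∀ {a a'} → RA a a' → SumEq RA RB (inj₁ a) (inj₁ a')
  ₂≈₂ : ∀ {b b'} → RB b b' → SumEq RA RB (inj₂ b) (inj₂ b')

_⊕_ : LinOrd → LinOrd → LinOrd
X ⊕ Y = record { Carrier = Carrier X ⊎ Carrier Y ; _<_ = SumLt (_<_ X) (_<_ Y) }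

infixl 6 _⊕_

_+ᵉ_ : ∀ (γ : LinOrd) {m n} → (Fin m → Fin n) → Carrier (γ ⊕ fin m) → Carrier (γ ⊕ fin n)
γ +ᵉ f = Sum.map₂ f

+ᵉ-inc : ∀ (γ : LinOrd) {m n} {f : Fin m → Fin n} → FinIncreasing f →
         Increasing (γ ⊕ fin m) (γ ⊕ fin n) (γ +ᵉ f)
+ᵉ-inc γ p (₁<₁ q) = ₁<₁ q
+ᵉ-inc γ p ₁<₂     = ₁<₂
+ᵉ-inc γ p (₂<₂ q) = ₂<₂ (p q)

record RawPredilator : Set₁ where
  field
    Obj  : ℕ → Set
    _≈_  : ∀ {n} → Obj n → Obj n → Set
    _<_  : ∀ {n} → Obj n → Obj n → Set
    map  : ∀ {m n} (f : Fin m → Fin n) → FinIncreasing f → Obj m → Obj n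
    supp : ∀ {n} → Obj n → Fin n → Set

open RawPredilator public

record IsPredilator (D : RawPredilator) : Set where
  field
    isSTO    : ∀ n → IsStrictTotalOrder (_≈_ D {n}) (_<_ D {n})
    map-resp : ∀ {m n} (f : Fin m → Fin n) (p : FinIncreasing f) {σ τ : Obj D m} →
               _≈_ D σ τ → _≈_ D (map D f p σ) (map D f p τ)
    map-ext  : ∀ {m n} (f g : Fin m → Fin n) (p : FinIncreasing f) (q : FinIncreasing g) →
               (∀ i → f i ≡ g i) → ∀ (σ : Obj D m) → _≈_ D (map D f p σ) (map D g q σ)
    map-id   : ∀ {n} (p : FinIncreasing {n} id) (σ : Obj D n) → _≈_ D (map D id p σ) σ
    map-∘    : ∀ {l m n} (f : Fin l → Fin m) (g : Fin m → Fin n)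
               (p : FinIncreasing f) (q : FinIncreasing g) (r : FinIncreasing (g ∘ f)) (σ : Obj D l) →
               _≈_ D (map D (g ∘ f) r σ) (map D g q (map D f p σ))
    map-mono : ∀ {m n} (f : Fin m → Fin n) (p : FinIncreasing f) {σ τ : Obj D m} →
               _<_ D σ τ → _<_ D (map D f p σ) (map D f p τ)
    supp-resp : ∀ {n} {σ τ : Obj D n} → _≈_ D σ τ → ∀ i → supp D σ i → supp D τ i
    -- naturality: supp_n ∘ D(f) = f[·] ∘ supp_m
    supp-nat₁ : ∀ {m n} (f : Fin m → Fin n) (p : FinIncreasing f) (σ : Obj D m) (i : Fin n) →
                supp D (map D f p σ) i → ∃ λ j → supp D σ j × f j ≡ i
    supp-nat₂ : ∀ {m n} (f : Fin m → Fin n) (p : FinIncreasing f) (σ : Obj D m) (j : Fin m) →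
                supp D σ j → supp D (map D f p σ) (f j)
    supp-cond : ∀ {m n} (f : Fin m → Fin n) (p : FinIncreasing f) (σ : Obj D n) →
                (∀ i → supp D σ i → ∃ λ j → f j ≡ i) → ∃ λ σ' → _≈_ D (map D f p σ') σ

-- Extension of a predilator to an arbitrary linear order X.
-- An element of D(X) is (σ; a_0 < … < a_{n-1}) with supp_n(σ) = n.

record Elt (D : RawPredilator) (X : LinOrd) : Set where
  constructor elt
  field
    size     : ℕ
    shape    : Obj D size
    args     : Fin size → Carrier X
    args-inc : Increasing (fin size) X args
    full     : ∀ i → supp D shape i

open Elt public

-- comparison by transport into D(|a ∪ b|): e enumerates a ∪ b increasingly,
-- f, g are the positions of a, b in that enumeration.
record Transport (D : RawPredilator) (X : LinOrd)
                 (R : ∀ {k} → Obj D k → Obj D k → Set) (s t : Elt D X) : Set where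
  field
    k     : ℕ
    f     : Fin (size s) → Fin k
    f-inc : FinIncreasing f
    g     : Fin (size t) → Fin k
    g-inc : FinIncreasing g
    e     : Fin k → Carrier X
    e-inc : Increasing (fin k) X e
    e∘f   : ∀ i → args s i ≡ e (f i)
    e∘g   : ∀ j → args t j ≡ e (g j)
    cover : ∀ l → (∃ λ i → f i ≡ l) ⊎ (∃ λ j → g j ≡ l)
    rel   : R (map D f f-inc (shape s)) (map D g g-inc (shape t))

EltLt : (D : RawPredilator) (X : LinOrd) → Elt D X → Elt D X → Set
EltLt D X = Transport D X (_<_ D)

EltEq : (D : RawPredilator) (X : LinOrd) → Elt D X → Elt D X → Set
EltEq D X = Transport D X (_≈_ D)

eltMap : (D : RawPredilator) {X Y : LinOrd} (h : Carrier X → Carrier Y) →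
         Increasing X Y h → Elt D X → Elt D Y
eltMap D h p (elt n σ a a-inc full) = elt n σ (h ∘ a) (p ∘ a-inc) full

eltSupp : (D : RawPredilator) {X : LinOrd} → Elt D X → Carrier X → Set
eltSupp D s x = ∃ λ i → args s i ≡ x

_⟨_⟩ : RawPredilator → LinOrd → LinOrd
D ⟨ X ⟩ = record { Carrier = Elt D X ; _<_ = EltLt D X }

IsDilator : RawPredilator → Set₁
IsDilator D = IsPredilator D × (∀ (X : LinOrd) → IsWellOrder X → WellFounded (EltLt D X))

_^_ : RawPredilator → LinOrd → RawPredilator
D ^ γ = record
  { Obj  = λ n → Elt D (γ ⊕ fin n)
  ; _≈_  = λ {n} → EltEq D (γ ⊕ fin n)
  ; _<_  = λ {n} → EltLt D (γ ⊕ fin n)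
  ; map  = λ f p → eltMap D (γ +ᵉ f) (+ᵉ-inc γ p)
  ; supp = λ s x → ∃ λ i → args s i ≡ inj₂ x
  }

_⊞_ : RawPredilator → RawPredilator → RawPredilator
D ⊞ E = record
  { Obj  = λ n → Obj D n ⊎ Obj E n
  ; _≈_  = SumEq (_≈_ D) (_≈_ E)
  ; _<_  = SumLt (_<_ D) (_<_ E)
  ; map  = λ f p → Sum.map (map D f p) (map E f p)
  ; supp = λ { (inj₁ σ) → supp D σ ; (inj₂ τ) → supp E τ }
  }

record IsPsiFixedPoint (D : RawPredilator) (θ : LinOrd) : Set where
  field
    π     : Carrier θ → Elt D θ
    π-emb : Increasing θ (D ⟨ θ ⟩) π
    π-supp : ∀ α β → eltSupp D (π β) α → _<_ θ α β
    π-gap : ∀ (τ : Elt D θ) → (∀ α → eltSupp D τ α → EltLt D θ (π α) τ) →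
            ∃ λ α → EltEq D θ (π α) τ

{-# OPTIONS --safe #-}
-- Flattening identifies (D ^ γ) ⟨ Y ⟩ with D ⟨ γ ⊕ Y ⟩ as linear orders, naturally in Y, so a
-- ψ-fixed point θ of D ^ γ amounts to an embedding π : θ → D ⟨ γ ⊕ θ ⟩ whose values have their
-- θ-supports below them and which hits every τ whose θ-supports it already maps below τ.
-- For D ⊞ E over γ, send α ∈ θ to π_D α ∈ D ⟨ γ ⊕ θ ⟩ ⊆ D ⟨ γ ⊕ (θ ⊕ θ') ⟩ and β ∈ θ' to
-- π_E β ∈ E ⟨ (γ ⊕ θ) ⊕ θ' ⟩ = E ⟨ γ ⊕ (θ ⊕ θ') ⟩. As D-elements precede E-elements this is an
-- embedding. If τ lies in the D-part and all its supports are dominated, none of them lies in θ'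
-- (otherwise an E-element would be below τ), so τ comes from D ⟨ γ ⊕ θ ⟩ and the gap condition of
-- π_D applies; in the E-part the gap condition of π_E applies after reassociating.
module Submission where

open import Defs
open import Data.Nat using (ℕ; zero; suc; z<s; s<s; s<s⁻¹)
open import Data.Fin using (Fin; zero; suc; lift)
import Data.Fin.Properties as Fin
open import Data.Vec.Functional using (_∷_)
open import Data.Sum using (_⊎_; inj₁; inj₂)
import Data.Sum as Sum
open import Data.Sum.Properties using (inj₁-injective; inj₂-injective)
open import Data.Product using (∃; _×_; _,_; proj₁; proj₂)
import Data.Product as Product
open import Relation.Binary.Structures using (IsStrictTotalOrder)
open import Relation.Binary.Structures.Biased using (isStrictTotalOrderᶜ)
open import Relation.Binary.Definitions using (Trichotomous; tri<; tri≈; tri>)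
open import Relation.Binary.PropositionalEquality
  using (_≡_; _≗_; refl; sym; trans; cong; subst; subst₂; isEquivalence)
open import Data.Empty using (⊥-elim)
open import Function using (_∘_; id)

StrictTotal : LinOrd → Set
StrictTotal X = IsStrictTotalOrder _≡_ (_<_ X)

module _ {X Y : LinOrd} (X-sto : StrictTotal X) (Y-sto : StrictTotal Y) where
  private
    module X = IsStrictTotalOrder X-sto
    module Y = IsStrictTotalOrder Y-sto
    _<X_ : Carrier X → Carrier X → Set
    _<X_ = _<_ X
    _<Y_ : Carrier Y → Carrier Y → Set
    _<Y_ = _<_ Y

  ⊕-strictTotal : StrictTotal (X ⊕ Y)
  ⊕-strictTotal = isStrictTotalOrderᶜ record
    { isEquivalence = isEquivalence ; trans = <-trans ; compare = <-compare }
    where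
    <-trans : ∀ {u v w} → SumLt _<X_ _<Y_ u v → SumLt _<X_ _<Y_ v w → SumLt _<X_ _<Y_ u w
    <-trans (₁<₁ p) (₁<₁ q) = ₁<₁ (X.trans p q)
    <-trans (₁<₁ _) ₁<₂     = ₁<₂
    <-trans ₁<₂     (₂<₂ _) = ₁<₂
    <-trans (₂<₂ p) (₂<₂ q) = ₂<₂ (Y.trans p q)
    <-compare : Trichotomous _≡_ (SumLt _<X_ _<Y_)
    <-compare (inj₁ x) (inj₂ y) = tri< ₁<₂ (λ ()) (λ ())
    <-compare (inj₂ y) (inj₁ x) = tri> (λ ()) (λ ()) ₁<₂
    <-compare (inj₁ x) (inj₁ x') with X.compare x x'
    ... | tri< p ¬q ¬r = tri< (₁<₁ p) (¬q ∘ inj₁-injective) λ { (₁<₁ r) → ¬r r }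
    ... | tri≈ ¬p q ¬r = tri≈ (λ { (₁<₁ p) → ¬p p }) (cong inj₁ q) λ { (₁<₁ r) → ¬r r }
    ... | tri> ¬p ¬q r = tri> (λ { (₁<₁ p) → ¬p p }) (¬q ∘ inj₁-injective) (₁<₁ r)
    <-compare (inj₂ y) (inj₂ y') with Y.compare y y'
    ... | tri< p ¬q ¬r = tri< (₂<₂ p) (¬q ∘ inj₂-injective) λ { (₂<₂ r) → ¬r r }
    ... | tri≈ ¬p q ¬r = tri≈ (λ { (₂<₂ p) → ¬p p }) (cong inj₂ q) λ { (₂<₂ r) → ¬r r }
    ... | tri> ¬p ¬q r = tri> (λ { (₂<₂ p) → ¬p p }) (¬q ∘ inj₂-injective) (₂<₂ r)

  module _ {h : Carrier X → Carrier Y} (h-inc : Increasing X Y h) where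

    increasing⇒injective : ∀ {x x'} → h x ≡ h x' → x ≡ x'
    increasing⇒injective {x} {x'} hx≡hx' with X.compare x x'
    ... | tri< x<x' _ _ = ⊥-elim (Y.irrefl hx≡hx' (h-inc x<x'))
    ... | tri≈ _ x≡x' _ = x≡x'
    ... | tri> _ _ x'<x = ⊥-elim (Y.irrefl (sym hx≡hx') (h-inc x'<x))

    increasing⇒reflecting : ∀ {x x'} → h x <Y h x' → x <X x'
    increasing⇒reflecting {x} {x'} hx<hx' with X.compare x x'
    ... | tri< x<x' _ _ = x<x'
    ... | tri≈ _ refl _ = ⊥-elim (Y.irrefl refl hx<hx')
    ... | tri> _ _ x'<x = ⊥-elim (Y.irrefl refl (Y.trans hx<hx' (h-inc x'<x)))

map₂-increasing : ∀ {G X Y : LinOrd} {h : Carrier X → Carrier Y} →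
                  Increasing X Y h → Increasing (G ⊕ X) (G ⊕ Y) (Sum.map₂ h)
map₂-increasing h-inc (₁<₁ p) = ₁<₁ p
map₂-increasing h-inc ₁<₂     = ₁<₂
map₂-increasing h-inc (₂<₂ p) = ₂<₂ (h-inc p)

₁<₁⁻¹ : ∀ {A B : Set} {RA : A → A → Set} {RB : B → B → Set} {a a'} →
        SumLt RA RB (inj₁ a) (inj₁ a') → RA a a'
₁<₁⁻¹ (₁<₁ r) = r

₂<₂⁻¹ : ∀ {A B : Set} {RA : A → A → Set} {RB : B → B → Set} {b b'} →
        SumLt RA RB (inj₂ b) (inj₂ b') → RB b b'
₂<₂⁻¹ (₂<₂ r) = r

map₂-factor : ∀ {A B C Z : Set} {a : B → Z} {e : C → Z} {f : B → C} →
              a ≗ e ∘ f → Sum.map₂ {A = A} e ∘ Sum.map₂ f ≗ Sum.map₂ a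
map₂-factor a≗e∘f (inj₁ _) = refl
map₂-factor a≗e∘f (inj₂ x) = cong inj₂ (sym (a≗e∘f x))

map₂≡inj₂ : ∀ {A B C : Set} {h : B → C} (w : A ⊎ B) {z} → Sum.map₂ h w ≡ inj₂ z →
            ∃ λ x → w ≡ inj₂ x × h x ≡ z
map₂≡inj₂ (inj₂ x) refl = x , refl , refl

assocʳ-increasing : ∀ {X Y Z : LinOrd} → Increasing ((X ⊕ Y) ⊕ Z) (X ⊕ (Y ⊕ Z)) Sum.assocʳ
assocʳ-increasing (₁<₁ (₁<₁ p))           = ₁<₁ p
assocʳ-increasing (₁<₁ ₁<₂)               = ₁<₂
assocʳ-increasing (₁<₁ (₂<₂ p))           = ₂<₂ (₁<₁ p)
assocʳ-increasing {x = inj₁ (inj₁ _)} ₁<₂ = ₁<₂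
assocʳ-increasing {x = inj₁ (inj₂ _)} ₁<₂ = ₂<₂ ₁<₂
assocʳ-increasing (₂<₂ p)                 = ₂<₂ (₂<₂ p)

assocʳ-surjective : ∀ {A B C : Set} (z : A ⊎ (B ⊎ C)) → ∃ λ w → Sum.assocʳ w ≡ z
assocʳ-surjective (inj₁ x)        = inj₁ (inj₁ x) , refl
assocʳ-surjective (inj₂ (inj₁ y)) = inj₁ (inj₂ y) , refl
assocʳ-surjective (inj₂ (inj₂ z)) = inj₂ z , refl

-- Interleavings of increasing sequences

-- A Transport without its comparison in D.
record Interleaving (X : LinOrd) {m n : ℕ} (a : Fin m → Carrier X) (b : Fin n → Carrier X) : Set where
  field
    k     : ℕ
    f     : Fin m → Fin k
    f-inc : FinIncreasing f
    g     : Fin n → Fin k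
    g-inc : FinIncreasing g
    e     : Fin k → Carrier X
    e-inc : Increasing (fin k) X e
    e∘f   : ∀ i → a i ≡ e (f i)
    e∘g   : ∀ j → b j ≡ e (g j)
    cover : ∀ l → (∃ λ i → f i ≡ l) ⊎ (∃ λ j → g j ≡ l)

module _ {X : LinOrd} {m n : ℕ} {a : Fin m → Carrier X} {b : Fin n → Carrier X} where

  Interleaving-cong : ∀ {a' b'} → a ≗ a' → b ≗ b' → Interleaving X a b → Interleaving X a' b'
  Interleaving-cong a≗a' b≗b' I = record
    { I hiding (e∘f; e∘g)
    ; e∘f = λ i → trans (sym (a≗a' i)) (I.e∘f i) ; e∘g = λ j → trans (sym (b≗b' j)) (I.e∘g j) }
    where module I = Interleaving I

  Interleaving-map : ∀ {Y : LinOrd} {h : Carrier X → Carrier Y} → Increasing X Y h →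
                     Interleaving X a b → Interleaving Y (h ∘ a) (h ∘ b)
  Interleaving-map {h = h} h-inc I = record
    { I hiding (e; e-inc; e∘f; e∘g)
    ; e = h ∘ I.e ; e-inc = h-inc ∘ I.e-inc ; e∘f = cong h ∘ I.e∘f ; e∘g = cong h ∘ I.e∘g }
    where module I = Interleaving I

  Interleaving-comap : ∀ {Y : LinOrd} {h : Carrier X → Carrier Y} →
                       StrictTotal X → StrictTotal Y → Increasing X Y h →
                       Interleaving Y (h ∘ a) (h ∘ b) → Interleaving X a b
  Interleaving-comap {Y} {h} X-sto Y-sto h-inc I = record
    { Interleaving I hiding (e; e-inc; e∘f; e∘g)
    ; e = e' ; e-inc = e'-inc ; e∘f = λ i → h-injective (trans (e∘f i) (sym (h∘e' (f i))))
    ; e∘g = λ j → h-injective (trans (e∘g j) (sym (h∘e' (g j)))) }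
    where
    open Interleaving I
    h-injective : ∀ {x x'} → h x ≡ h x' → x ≡ x'
    h-injective = increasing⇒injective X-sto Y-sto h-inc
    preimage : ∀ {l} → (∃ λ i → f i ≡ l) ⊎ (∃ λ j → g j ≡ l) → Carrier X
    preimage (inj₁ (i , _)) = a i
    preimage (inj₂ (j , _)) = b j
    h∘preimage : ∀ {l} (c : (∃ λ i → f i ≡ l) ⊎ (∃ λ j → g j ≡ l)) → h (preimage c) ≡ e l
    h∘preimage (inj₁ (i , refl)) = e∘f i
    h∘preimage (inj₂ (j , refl)) = e∘g j
    e' : Fin k → Carrier X
    e' l = preimage (cover l)
    h∘e' : ∀ l → h (e' l) ≡ e l
    h∘e' l = h∘preimage (cover l)
    e'-inc : Increasing (fin k) X e'
    e'-inc {l} {l'} l<l' = increasing⇒reflecting X-sto Y-sto h-inc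
      (subst₂ (_<_ Y) (sym (h∘e' l)) (sym (h∘e' l')) (e-inc l<l'))

Interleaving-lowerBound : ∀ {X : LinOrd} {m n} {a : Fin m → Carrier X} {b : Fin n → Carrier X}
                         (I : Interleaving X a b) {x} → (∀ i → _<_ X x (a i)) → (∀ j → _<_ X x (b j)) →
                         ∀ l → _<_ X x (Interleaving.e I l)
Interleaving-lowerBound {X} I {x} x<a x<b l with Interleaving.cover I l
... | inj₁ (i , refl) = subst (_<_ X x) (Interleaving.e∘f I i) (x<a i)
... | inj₂ (j , refl) = subst (_<_ X x) (Interleaving.e∘g I j) (x<b j)

lift-increasing : ∀ {m k} {f : Fin m → Fin k} → FinIncreasing f → FinIncreasing (lift 1 f)
lift-increasing f-inc {zero}  {suc _} _       = z<s
lift-increasing f-inc {suc _} {suc _} i<j     = s<s (f-inc (s<s⁻¹ i<j))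

∷-increasing : ∀ {X : LinOrd} {k x} {e : Fin k → Carrier X} → Increasing (fin k) X e →
               (∀ l → _<_ X x (e l)) → Increasing (fin (suc k)) X (x ∷ e)
∷-increasing e-inc x<e {zero}  {suc l} _    = x<e l
∷-increasing e-inc x<e {suc _} {suc _} l<l' = e-inc (s<s⁻¹ l<l')

module _ {X : LinOrd} (X-sto : StrictTotal X) where
  private
    module X = IsStrictTotalOrder X-sto
    _<X_ : Carrier X → Carrier X → Set
    _<X_ = _<_ X

  <head⇒<all : ∀ {n x} {b : Fin (suc n) → Carrier X} → Increasing (fin (suc n)) X b →
               x <X b zero → ∀ j → x <X b j
  <head⇒<all b-inc x<b₀ zero    = x<b₀
  <head⇒<all b-inc x<b₀ (suc j) = X.trans x<b₀ (b-inc z<s)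

  module _ {m n} {a : Fin (suc m) → Carrier X} {b : Fin (suc n) → Carrier X}
           (a-inc : Increasing (fin (suc m)) X a) (b-inc : Increasing (fin (suc n)) X b) where

    prependˡ : a zero <X b zero → Interleaving X (a ∘ suc) b → Interleaving X a b
    prependˡ a₀<b₀ I = record
      { k = suc k ; f = lift 1 f ; f-inc = lift-increasing f-inc
      ; g = suc ∘ g ; g-inc = s<s ∘ g-inc
      ; e = a zero ∷ e
      ; e-inc = ∷-increasing {X} e-inc (Interleaving-lowerBound I (λ _ → a-inc z<s) (<head⇒<all b-inc a₀<b₀))
      ; e∘f = λ { zero → refl ; (suc i) → e∘f i } ; e∘g = e∘g
      ; cover = λ { zero → inj₁ (zero , refl)
                  ; (suc l) → Sum.map (Product.map suc (cong suc)) (Product.map₂ (cong suc)) (cover l) } }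
      where open Interleaving I

    prependʳ : b zero <X a zero → Interleaving X a (b ∘ suc) → Interleaving X a b
    prependʳ b₀<a₀ I = record
      { k = suc k ; f = suc ∘ f ; f-inc = s<s ∘ f-inc
      ; g = lift 1 g ; g-inc = lift-increasing g-inc
      ; e = b zero ∷ e
      ; e-inc = ∷-increasing {X} e-inc (Interleaving-lowerBound I (<head⇒<all a-inc b₀<a₀) (λ _ → b-inc z<s))
      ; e∘f = e∘f ; e∘g = λ { zero → refl ; (suc j) → e∘g j }
      ; cover = λ { zero → inj₂ (zero , refl)
                  ; (suc l) → Sum.map (Product.map₂ (cong suc)) (Product.map suc (cong suc)) (cover l) } }
      where open Interleaving I

    prependˡʳ : a zero ≡ b zero → Interleaving X (a ∘ suc) (b ∘ suc) → Interleaving X a b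
    prependˡʳ a₀≡b₀ I = record
      { k = suc k ; f = lift 1 f ; f-inc = lift-increasing f-inc
      ; g = lift 1 g ; g-inc = lift-increasing g-inc
      ; e = a zero ∷ e
      ; e-inc = ∷-increasing {X} e-inc
          (Interleaving-lowerBound I (λ _ → a-inc z<s) (λ _ → subst (_<X b (suc _)) (sym a₀≡b₀) (b-inc z<s)))
      ; e∘f = λ { zero → refl ; (suc i) → e∘f i } ; e∘g = λ { zero → sym a₀≡b₀ ; (suc j) → e∘g j }
      ; cover = λ { zero → inj₁ (zero , refl)
                  ; (suc l) → Sum.map (Product.map suc (cong suc)) (Product.map suc (cong suc)) (cover l) } }
      where open Interleaving I

  merge : ∀ {m n} {a : Fin m → Carrier X} {b : Fin n → Carrier X} →
          Increasing (fin m) X a → Increasing (fin n) X b → Interleaving X a b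
  merge {zero} {n} {b = b} _ b-inc = record
    { k = n ; f = λ () ; f-inc = λ {} ; g = id ; g-inc = id ; e = b ; e-inc = b-inc
    ; e∘f = λ () ; e∘g = λ _ → refl ; cover = λ l → inj₂ (l , refl) }
  merge {suc m} {zero} {a = a} a-inc _ = record
    { k = suc m ; f = id ; f-inc = id ; g = λ () ; g-inc = λ {} ; e = a ; e-inc = a-inc
    ; e∘f = λ _ → refl ; e∘g = λ () ; cover = λ l → inj₁ (l , refl) }
  merge {suc m} {suc n} {a} {b} a-inc b-inc with X.compare (a zero) (b zero)
  ... | tri< a₀<b₀ _ _ = prependˡ a-inc b-inc a₀<b₀ (merge (a-inc ∘ s<s) b-inc)
  ... | tri≈ _ a₀≡b₀ _ = prependˡʳ a-inc b-inc a₀≡b₀ (merge (a-inc ∘ s<s) (b-inc ∘ s<s))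
  ... | tri> _ _ b₀<a₀ = prependʳ a-inc b-inc b₀<a₀ (merge a-inc (b-inc ∘ s<s))

module _ {D : RawPredilator} {R : ∀ {k} → Obj D k → Obj D k → Set} where

  interleaving : ∀ {X s t} → Transport D X R s t → Interleaving X (args s) (args t)
  interleaving T = record { Transport T hiding (rel) }

  transport : ∀ {X s t} (I : Interleaving X (args s) (args t)) → let open Interleaving I in
              R (map D f f-inc (shape s)) (map D g g-inc (shape t)) → Transport D X R s t
  transport I r = record { Interleaving I ; rel = r }

  Transport-cong : ∀ {X m n σ τ} {a a' : Fin m → Carrier X} {b b' : Fin n → Carrier X}
                   {a-inc : Increasing (fin m) X a} {a'-inc : Increasing (fin m) X a'}
                   {b-inc : Increasing (fin n) X b} {b'-inc : Increasing (fin n) X b'}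
                   {a-full a'-full : ∀ i → supp D σ i} {b-full b'-full : ∀ j → supp D τ j} →
                   a ≗ a' → b ≗ b' →
                   Transport D X R (elt m σ a a-inc a-full) (elt n τ b b-inc b-full) →
                   Transport D X R (elt m σ a' a'-inc a'-full) (elt n τ b' b'-inc b'-full)
  Transport-cong a≗a' b≗b' T = transport (Interleaving-cong a≗a' b≗b' (interleaving T)) (Transport.rel T)

  Transport-map : ∀ {X Y : LinOrd} {h : Carrier X → Carrier Y} (h-inc : Increasing X Y h) {s t} →
                  Transport D X R s t → Transport D Y R (eltMap D h h-inc s) (eltMap D h h-inc t)
  Transport-map h-inc T = transport (Interleaving-map h-inc (interleaving T)) (Transport.rel T)

  Transport-comap : ∀ {X Y : LinOrd} {h : Carrier X → Carrier Y} → StrictTotal X → StrictTotal Y →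
                    (h-inc : Increasing X Y h) {s t : Elt D X} →
                    Transport D Y R (eltMap D h h-inc s) (eltMap D h h-inc t) → Transport D X R s t
  Transport-comap X-sto Y-sto h-inc T =
    transport (Interleaving-comap X-sto Y-sto h-inc (interleaving T)) (Transport.rel T)

module _ {D : RawPredilator} {X Y : LinOrd} (X-sto : StrictTotal X) (Y-sto : StrictTotal Y)
         {h : Carrier X → Carrier Y} (h-inc : Increasing X Y h) where

  module _ (s : Elt D Y) (pre : ∀ i → ∃ λ x → h x ≡ args s i) where

    eltPreimage : Elt D X
    eltPreimage = elt (size s) (shape s) (proj₁ ∘ pre) pre-inc (full s)
      where
      pre-inc : Increasing (fin (size s)) X (proj₁ ∘ pre)
      pre-inc {i} {j} i<j = increasing⇒reflecting X-sto Y-sto h-inc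
        (subst₂ (_<_ Y) (sym (proj₂ (pre i))) (sym (proj₂ (pre j))) (args-inc s i<j))

    module _ {R : ∀ {k} → Obj D k → Obj D k → Set} {t : Elt D X} where

      Transport-eltPreimage : Transport D Y R (eltMap D h h-inc t) s → Transport D X R t eltPreimage
      Transport-eltPreimage = Transport-comap X-sto Y-sto h-inc ∘ Transport-cong (λ _ → refl) (sym ∘ proj₂ ∘ pre)

      Transport-eltPreimage⁻ : Transport D X R t eltPreimage → Transport D Y R (eltMap D h h-inc t) s
      Transport-eltPreimage⁻ = Transport-cong (λ _ → refl) (proj₂ ∘ pre) ∘ Transport-map h-inc

module _ {D E : RawPredilator} {X : LinOrd} where

  inj₁ᵉ : Elt D X → Elt (D ⊞ E) X
  inj₁ᵉ (elt n σ a a-inc full) = elt n (inj₁ σ) a a-inc full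

  inj₂ᵉ : Elt E X → Elt (D ⊞ E) X
  inj₂ᵉ (elt n τ a a-inc full) = elt n (inj₂ τ) a a-inc full

  module _ {R : ∀ {k} → Obj D k → Obj D k → Set} {R' : ∀ {k} → Obj (D ⊞ E) k → Obj (D ⊞ E) k → Set} where

    Transport-inj₁ : (∀ {k} {σ σ' : Obj D k} → R σ σ' → R' (inj₁ σ) (inj₁ σ')) →
                     ∀ {s t} → Transport D X R s t → Transport (D ⊞ E) X R' (inj₁ᵉ s) (inj₁ᵉ t)
    Transport-inj₁ r T = transport (interleaving T) (r (Transport.rel T))

    Transport-inj₁⁻ : (∀ {k} {σ σ' : Obj D k} → R' (inj₁ σ) (inj₁ σ') → R σ σ') →
                      ∀ {s t} → Transport (D ⊞ E) X R' (inj₁ᵉ s) (inj₁ᵉ t) → Transport D X R s t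
    Transport-inj₁⁻ r T = transport (interleaving T) (r (Transport.rel T))

  module _ {R : ∀ {k} → Obj E k → Obj E k → Set} {R' : ∀ {k} → Obj (D ⊞ E) k → Obj (D ⊞ E) k → Set} where

    Transport-inj₂ : (∀ {k} {τ τ' : Obj E k} → R τ τ' → R' (inj₂ τ) (inj₂ τ')) →
                     ∀ {s t} → Transport E X R s t → Transport (D ⊞ E) X R' (inj₂ᵉ s) (inj₂ᵉ t)
    Transport-inj₂ r T = transport (interleaving T) (r (Transport.rel T))

    Transport-inj₂⁻ : (∀ {k} {τ τ' : Obj E k} → R' (inj₂ τ) (inj₂ τ') → R τ τ') →
                      ∀ {s t} → Transport (D ⊞ E) X R' (inj₂ᵉ s) (inj₂ᵉ t) → Transport E X R s t
    Transport-inj₂⁻ r T = transport (interleaving T) (r (Transport.rel T))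

  inj₁ᵉ<inj₂ᵉ : StrictTotal X → ∀ s t → EltLt (D ⊞ E) X (inj₁ᵉ s) (inj₂ᵉ t)
  inj₁ᵉ<inj₂ᵉ X-sto s t = transport (merge X-sto (args-inc s) (args-inc t)) ₁<₂

-- Flattening (D ^ γ) ⟨ Y ⟩ ≅ D ⟨ γ ⊕ Y ⟩

module _ {D : RawPredilator} {γ Y : LinOrd} where

  flatten : Elt (D ^ γ) Y → Elt D (γ ⊕ Y)
  flatten s = elt (size (shape s)) (shape (shape s)) (Sum.map₂ (args s) ∘ args (shape s))
                  (map₂-increasing (args-inc s) ∘ args-inc (shape s)) (full (shape s))

  record Split {m : ℕ} (x : Fin m → Carrier (γ ⊕ Y)) : Set where
    field
      n      : ℕ
      c      : Fin m → Carrier (γ ⊕ fin n)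
      c-inc  : Increasing (fin m) (γ ⊕ fin n) c
      a      : Fin n → Carrier Y
      a-inc  : Increasing (fin n) Y a
      c-full : ∀ i → ∃ λ j → c j ≡ inj₂ i
      a∘c    : ∀ j → Sum.map₂ a (c j) ≡ x j

  module _ {m} {x : Fin (suc m) → Carrier (γ ⊕ Y)} (x-inc : Increasing (fin (suc m)) (γ ⊕ Y) x)
           (S : Split (x ∘ suc)) where
    open Split S

    private
      x₀<x : ∀ {x₀} → x zero ≡ x₀ → ∀ j → SumLt (_<_ γ) (_<_ Y) x₀ (Sum.map₂ a (c j))
      x₀<x x₀≡ j = subst₂ (SumLt (_<_ γ) (_<_ Y)) x₀≡ (sym (a∘c j)) (x-inc z<s)

    Split-consˡ : ∀ {g} → x zero ≡ inj₁ g → Split x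
    Split-consˡ {g} x₀≡ = record
      { n = n ; c = inj₁ g ∷ c ; c-inc = ∷-increasing {γ ⊕ fin n} c-inc (λ j → below (c j) (x₀<x x₀≡ j))
      ; a = a ; a-inc = a-inc ; c-full = λ i → let (j , p) = c-full i in suc j , p
      ; a∘c = λ { zero → sym x₀≡ ; (suc j) → a∘c j } }
      where
      below : ∀ w → SumLt (_<_ γ) (_<_ Y) (inj₁ g) (Sum.map₂ a w) → SumLt (_<_ γ) (_<_ (fin n)) (inj₁ g) w
      below (inj₁ _) (₁<₁ g<w) = ₁<₁ g<w
      below (inj₂ _) _         = ₁<₂

    Split-consʳ : ∀ {y} → x zero ≡ inj₂ y → Split x
    Split-consʳ {y} x₀≡ = record
      { n = suc n ; c = inj₂ zero ∷ Sum.map₂ suc ∘ c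
      ; c-inc = ∷-increasing {γ ⊕ fin (suc n)} (map₂-increasing s<s ∘ c-inc) (λ j → below (c j) (x₀<x x₀≡ j))
      ; a = y ∷ a ; a-inc = ∷-increasing {Y} a-inc y<a
      ; c-full = λ { zero → zero , refl ; (suc i) → let (j , p) = c-full i in suc j , cong (Sum.map₂ suc) p }
      ; a∘c = λ { zero → sym x₀≡ ; (suc j) → trans (map₂-factor (λ _ → refl) (c j)) (a∘c j) } }
      where
      below : ∀ w → SumLt (_<_ γ) (_<_ Y) (inj₂ y) (Sum.map₂ a w) →
              SumLt (_<_ γ) (_<_ (fin (suc n))) (inj₂ zero) (Sum.map₂ suc w)
      below (inj₂ _) _ = ₂<₂ z<s
      y<a : ∀ i → _<_ Y y (a i)
      y<a i = let (j , cj≡i) = c-full i in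
        ₂<₂⁻¹ (subst (λ w → SumLt (_<_ γ) (_<_ Y) (inj₂ y) (Sum.map₂ a w)) cj≡i (x₀<x x₀≡ j))

  split : ∀ {m} {x : Fin m → Carrier (γ ⊕ Y)} → Increasing (fin m) (γ ⊕ Y) x → Split x
  split {zero} _ = record
    { n = zero ; c = λ () ; c-inc = λ {} ; a = λ () ; a-inc = λ {} ; c-full = λ () ; a∘c = λ () }
  split {suc m} {x} x-inc with x zero in x₀≡
  ... | inj₁ _ = Split-consˡ x-inc (split (x-inc ∘ s<s)) x₀≡
  ... | inj₂ _ = Split-consʳ x-inc (split (x-inc ∘ s<s)) x₀≡

  unflatten : Elt D (γ ⊕ Y) → Elt (D ^ γ) Y
  unflatten (elt m σ x x-inc full) = elt n (elt m σ c c-inc full) a a-inc c-full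
    where open Split (split x-inc)

  flatten-unflatten : ∀ s → args (flatten (unflatten s)) ≗ args s
  flatten-unflatten s = Split.a∘c (split (args-inc s))

  eltSupp-unflatten : ∀ s {y} → eltSupp (D ^ γ) (unflatten s) y → eltSupp D s (inj₂ y)
  eltSupp-unflatten s (i , refl) = let (j , cj≡i) = Split.c-full S i in
    j , trans (sym (Split.a∘c S j)) (cong (Sum.map₂ (Split.a S)) cj≡i)
    where S = split (args-inc s)

  eltSupp-flatten : ∀ s {y} → eltSupp D (flatten s) (inj₂ y) → eltSupp (D ^ γ) s y
  eltSupp-flatten s (j , p) = let (i , _ , aᵢ≡y) = map₂≡inj₂ (args (shape s) j) p in i , aᵢ≡y

  module _ {R : ∀ {k} → Obj D k → Obj D k → Set} where

    Transport-flatten : ∀ {s t} → Transport (D ^ γ) Y (λ {k} → Transport D (γ ⊕ fin k) R) s t →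
                        Transport D (γ ⊕ Y) R (flatten s) (flatten t)
    Transport-flatten {s} {t} T = transport
      (Interleaving-cong (map₂-factor T.e∘f ∘ args (shape s)) (map₂-factor T.e∘g ∘ args (shape t))
        (Interleaving-map (map₂-increasing T.e-inc) (interleaving T.rel)))
      (Transport.rel T.rel)
      where module T = Transport T

    Transport-unflatten : StrictTotal γ → StrictTotal Y → ∀ {s t} →
                          Transport D (γ ⊕ Y) R (flatten s) (flatten t) →
                          Transport (D ^ γ) Y (λ {k} → Transport D (γ ⊕ fin k) R) s t
    Transport-unflatten γ-sto Y-sto {s} {t} T = transport M (transport
      (Interleaving-comap (⊕-strictTotal γ-sto Fin.<-isStrictTotalOrder) (⊕-strictTotal γ-sto Y-sto)
        (map₂-increasing M.e-inc)
        (Interleaving-cong (sym ∘ map₂-factor M.e∘f ∘ args (shape s)) (sym ∘ map₂-factor M.e∘g ∘ args (shape t))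
          (interleaving T)))
      (Transport.rel T))
      where
      M : Interleaving Y (args s) (args t)
      M = merge Y-sto (args-inc s) (args-inc t)
      module M = Interleaving M

    Transport-flattenˡ : ∀ {s t} → Transport (D ^ γ) Y (λ {k} → Transport D (γ ⊕ fin k) R) (unflatten s) t →
                         Transport D (γ ⊕ Y) R s (flatten t)
    Transport-flattenˡ {s} = Transport-cong (flatten-unflatten s) (λ _ → refl) ∘ Transport-flatten

    Transport-flattenʳ : ∀ {s t} → Transport (D ^ γ) Y (λ {k} → Transport D (γ ⊕ fin k) R) s (unflatten t) →
                         Transport D (γ ⊕ Y) R (flatten s) t
    Transport-flattenʳ {t = t} = Transport-cong (λ _ → refl) (flatten-unflatten t) ∘ Transport-flatten

    module _ (γ-sto : StrictTotal γ) (Y-sto : StrictTotal Y) where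

      Transport-unflattenˡ : ∀ {s t} → Transport D (γ ⊕ Y) R s (flatten t) →
                             Transport (D ^ γ) Y (λ {k} → Transport D (γ ⊕ fin k) R) (unflatten s) t
      Transport-unflattenˡ {s} =
        Transport-unflatten γ-sto Y-sto ∘ Transport-cong (sym ∘ flatten-unflatten s) (λ _ → refl)

      Transport-unflattenʳ : ∀ {s t} → Transport D (γ ⊕ Y) R (flatten s) t →
                             Transport (D ^ γ) Y (λ {k} → Transport D (γ ⊕ fin k) R) s (unflatten t)
      Transport-unflattenʳ {t = t} =
        Transport-unflatten γ-sto Y-sto ∘ Transport-cong (λ _ → refl) (sym ∘ flatten-unflatten t)

      Transport-unflatten² : ∀ {s t} → Transport D (γ ⊕ Y) R s t →
                             Transport (D ^ γ) Y (λ {k} → Transport D (γ ⊕ fin k) R) (unflatten s) (unflatten t)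
      Transport-unflatten² {s} {t} =
        Transport-unflatten γ-sto Y-sto ∘ Transport-cong (sym ∘ flatten-unflatten s) (sym ∘ flatten-unflatten t)

-- ψ-fixed points

-- IsPsiFixedPoint (D ^ γ) θ read through flatten, i.e. inside D ⟨ γ ⊕ θ ⟩.
record IsShiftedPsiFixedPoint (D : RawPredilator) (γ θ : LinOrd) : Set where
  field
    π      : Carrier θ → Elt D (γ ⊕ θ)
    π-emb  : Increasing θ (D ⟨ γ ⊕ θ ⟩) π
    π-supp : ∀ α β → eltSupp D (π β) (inj₂ α) → _<_ θ α β
    π-gap  : ∀ τ → (∀ α → eltSupp D τ (inj₂ α) → EltLt D (γ ⊕ θ) (π α) τ) →
             ∃ λ α → EltEq D (γ ⊕ θ) (π α) τ

module _ {D : RawPredilator} {γ θ : LinOrd} (γ-sto : StrictTotal γ) (θ-sto : StrictTotal θ) where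

  psi⇒shiftedPsi : IsPsiFixedPoint (D ^ γ) θ → IsShiftedPsiFixedPoint D γ θ
  psi⇒shiftedPsi P = record
    { π      = flatten ∘ P.π
    ; π-emb  = Transport-flatten ∘ P.π-emb
    ; π-supp = λ α β → P.π-supp α β ∘ eltSupp-flatten (P.π β)
    ; π-gap  = gap
    }
    where
    module P = IsPsiFixedPoint P
    gap : ∀ τ → (∀ α → eltSupp D τ (inj₂ α) → EltLt D (γ ⊕ θ) (flatten (P.π α)) τ) →
          ∃ λ α → EltEq D (γ ⊕ θ) (flatten (P.π α)) τ
    gap τ below = Product.map₂ Transport-flattenʳ (P.π-gap (unflatten τ)
      (λ α → Transport-unflattenʳ γ-sto θ-sto ∘ below α ∘ eltSupp-unflatten τ))

  shiftedPsi⇒psi : IsShiftedPsiFixedPoint D γ θ → IsPsiFixedPoint (D ^ γ) θ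
  shiftedPsi⇒psi S = record
    { π      = unflatten ∘ S.π
    ; π-emb  = Transport-unflatten² γ-sto θ-sto ∘ S.π-emb
    ; π-supp = λ α β → S.π-supp α β ∘ eltSupp-unflatten (S.π β)
    ; π-gap  = gap
    }
    where
    module S = IsShiftedPsiFixedPoint S
    gap : ∀ τ → (∀ α → eltSupp (D ^ γ) τ α → EltLt (D ^ γ) θ (unflatten (S.π α)) τ) →
          ∃ λ α → EltEq (D ^ γ) θ (unflatten (S.π α)) τ
    gap τ below = Product.map₂ (Transport-unflattenˡ γ-sto θ-sto) (S.π-gap (flatten τ)
      (λ α → Transport-flattenˡ ∘ below α ∘ eltSupp-flatten τ))

module _ {D E : RawPredilator} {γ θ θ' : LinOrd}
         (γ-sto : StrictTotal γ) (θ-sto : StrictTotal θ) (θ'-sto : StrictTotal θ') where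
  private
    Z : LinOrd
    Z = γ ⊕ (θ ⊕ θ')

    Z-sto : StrictTotal Z
    Z-sto = ⊕-strictTotal γ-sto (⊕-strictTotal θ-sto θ'-sto)

    γθ-sto : StrictTotal (γ ⊕ θ)
    γθ-sto = ⊕-strictTotal γ-sto θ-sto

    γθθ'-sto : StrictTotal ((γ ⊕ θ) ⊕ θ')
    γθθ'-sto = ⊕-strictTotal γθ-sto θ'-sto

    ι₁ : Carrier (γ ⊕ θ) → Carrier Z
    ι₁ = Sum.map₂ inj₁

    ι₁-inc : Increasing (γ ⊕ θ) Z ι₁
    ι₁-inc = map₂-increasing ₁<₁

  ⊞-shiftedPsi : IsShiftedPsiFixedPoint D γ θ → IsShiftedPsiFixedPoint E (γ ⊕ θ) θ' →
                 IsShiftedPsiFixedPoint (D ⊞ E) γ (θ ⊕ θ')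
  ⊞-shiftedPsi P Q = record { π = π ; π-emb = π-emb ; π-supp = π-supp ; π-gap = π-gap }
    where
    module P = IsShiftedPsiFixedPoint P
    module Q = IsShiftedPsiFixedPoint Q

    π : Carrier (θ ⊕ θ') → Elt (D ⊞ E) Z
    π (inj₁ α) = inj₁ᵉ (eltMap D ι₁ ι₁-inc (P.π α))
    π (inj₂ β) = inj₂ᵉ (eltMap E Sum.assocʳ assocʳ-increasing (Q.π β))

    π-emb : Increasing (θ ⊕ θ') ((D ⊞ E) ⟨ Z ⟩) π
    π-emb (₁<₁ α<α') = Transport-inj₁ ₁<₁ (Transport-map ι₁-inc (P.π-emb α<α'))
    π-emb ₁<₂        = inj₁ᵉ<inj₂ᵉ Z-sto _ _
    π-emb (₂<₂ β<β') = Transport-inj₂ ₂<₂ (Transport-map assocʳ-increasing (Q.π-emb β<β'))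

    π-supp : ∀ x y → eltSupp (D ⊞ E) (π y) (inj₂ x) → _<_ (θ ⊕ θ') x y
    π-supp x (inj₁ α) (i , p) with map₂≡inj₂ (args (P.π α) i) p
    ... | α' , πα-i≡α' , refl = ₁<₁ (P.π-supp α' α (i , πα-i≡α'))
    π-supp x (inj₂ β) (i , p) = below (args (Q.π β) i) refl p
      where
      below : ∀ w → args (Q.π β) i ≡ w → Sum.assocʳ w ≡ inj₂ x → _<_ (θ ⊕ θ') x (inj₂ β)
      below (inj₁ (inj₂ _)) _ refl = ₁<₂
      below (inj₂ β')       q refl = ₂<₂ (Q.π-supp β' β (i , q))

    π-gap : ∀ τ → (∀ x → eltSupp (D ⊞ E) τ (inj₂ x) → EltLt (D ⊞ E) Z (π x) τ) →
            ∃ λ x → EltEq (D ⊞ E) Z (π x) τ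
    π-gap (elt n (inj₁ σ) a a-inc full) below = Product.map inj₁ embed (P.π-gap τ′ below′)
      where
      τ₀ : Elt D Z
      τ₀ = elt n σ a a-inc full
      inγθ : ∀ i → ∃ λ x → ι₁ x ≡ a i
      inγθ i with a i in aᵢ≡
      ... | inj₁ g        = inj₁ g , refl
      ... | inj₂ (inj₁ α) = inj₂ α , refl
      -- a support point β ∈ θ' would put the E-element π (inj₂ β) below τ, which lies in D
      ... | inj₂ (inj₂ β) with Transport.rel (below (inj₂ β) (i , aᵢ≡))
      ... | ()
      τ′ : Elt D (γ ⊕ θ)
      τ′ = eltPreimage γθ-sto Z-sto ι₁-inc τ₀ inγθ
      below′ : ∀ α → eltSupp D τ′ (inj₂ α) → EltLt D (γ ⊕ θ) (P.π α) τ′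
      below′ α (i , p) = Transport-eltPreimage γθ-sto Z-sto ι₁-inc τ₀ inγθ
        (Transport-inj₁⁻ ₁<₁⁻¹ (below (inj₁ α) (i , trans (sym (proj₂ (inγθ i))) (cong ι₁ p))))
      embed : ∀ {α} → EltEq D (γ ⊕ θ) (P.π α) τ′ → EltEq (D ⊞ E) Z (π (inj₁ α)) (inj₁ᵉ τ₀)
      embed = Transport-inj₁ ₁≈₁ ∘ Transport-eltPreimage⁻ γθ-sto Z-sto ι₁-inc τ₀ inγθ
    π-gap (elt n (inj₂ ε) a a-inc full) below = Product.map inj₂ embed (Q.π-gap τ′ below′)
      where
      τ₀ : Elt E Z
      τ₀ = elt n ε a a-inc full
      pre : ∀ i → ∃ λ w → Sum.assocʳ w ≡ a i
      pre = assocʳ-surjective ∘ a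
      τ′ : Elt E ((γ ⊕ θ) ⊕ θ')
      τ′ = eltPreimage γθθ'-sto Z-sto assocʳ-increasing τ₀ pre
      below′ : ∀ β → eltSupp E τ′ (inj₂ β) → EltLt E ((γ ⊕ θ) ⊕ θ') (Q.π β) τ′
      below′ β (i , p) = Transport-eltPreimage γθθ'-sto Z-sto assocʳ-increasing τ₀ pre
        (Transport-inj₂⁻ ₂<₂⁻¹ (below (inj₂ β) (i , trans (sym (proj₂ (pre i))) (cong Sum.assocʳ p))))
      embed : ∀ {β} → EltEq E ((γ ⊕ θ) ⊕ θ') (Q.π β) τ′ → EltEq (D ⊞ E) Z (π (inj₂ β)) (inj₂ᵉ τ₀)
      embed = Transport-inj₂ ₂≈₂ ∘ Transport-eltPreimage⁻ γθθ'-sto Z-sto assocʳ-increasing τ₀ pre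

proposition5p7 : (D E : RawPredilator) → IsDilator D → IsDilator E →
    (γ : LinOrd) → IsWellOrder γ →
    (θ : LinOrd) → IsWellOrder θ → IsPsiFixedPoint (D ^ γ) θ →
    (θ' : LinOrd) → IsWellOrder θ' → IsPsiFixedPoint (E ^ (γ ⊕ θ)) θ' →
    IsPsiFixedPoint ((D ⊞ E) ^ γ) (θ ⊕ θ')
proposition5p7 D E _ _ γ (γ-sto , _) θ (θ-sto , _) P θ' (θ'-sto , _) Q =
  shiftedPsi⇒psi γ-sto (⊕-strictTotal θ-sto θ'-sto)
    (⊞-shiftedPsi γ-sto θ-sto θ'-sto
      (psi⇒shiftedPsi γ-sto θ-sto P)
      (psi⇒shiftedPsi (⊕-strictTotal γ-sto θ-sto) θ'-sto Q))
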